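{- Assume the Python floating-point type is identified with $\mathbb{R}$. For every deterministic hybrid program $\alpha$ (in the fragment det-HP) and all states $\nu,\omega$: if the compiled Python program $\mathrm{Py}(\alpha)$ started in state $\nu$ terminates in state $\omega$, i.e. $(\mathrm{Py}(\alpha),\nu)\rightarrow^*(\bot,\omega)$, then $(\nu,\omega)\in[\![\alpha]\!]$.
   Context: det-HP programs are generated by $\alpha,\beta::= x:=\theta \mid \alpha;\beta \mid (?P;\alpha)\cup(?\neg P;\beta) \mid (?P;\alpha)^*;?\neg P$, where $\theta$ is a term (literals, variables, unary minus, $+,-,\cdot,/$, exponentiation) and $P$ a quantifier-free real-arithmetic formula (comparisons $<,\le,=,\ne,\ge,>$ of terms, $\top,\bot,\neg,\wedge,\vee$). States map variables to reals. Semantics: $(\nu,\omega)\in[\![x:=\theta]\!]$ iff $\omega$ equals $\nu$ except $\omega(x)$ is the value of $\theta$ in $\nu$; $[\![?P]\!]=\{(\nu,\nu):\nu\models P\}$; $;$ is relational composition, $\cup$ union, ${}^*$ reflexive transitive closure. Compilation: $\mathrm{Py}(x:=\theta)=$\texttt{x=}$\mathrm{Py}(\theta)$; $\mathrm{Py}(\alpha;\beta)=\mathrm{Py}(\alpha)$\texttt{;}$\mathrm{Py}(\beta)$; $\mathrm{Py}((?P;\alpha)\cup(?\neg P;\beta))=$\texttt{if} $\mathrm{Py}(P)$\texttt{:} $\mathrm{Py}(\alpha)$ \texttt{else:} $\mathrm{Py}(\beta)$; $\mathrm{Py}((?P;\alpha)^*;?\neg P)=$\texttt{while} $\mathrm{Py}(P)$\texttt{:}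 $\mathrm{Py}(\alpha)$ \texttt{else pass}; terms and formulas compile operator by operator ($+,-,\cdot,/,{}^\wedge\mapsto$ \texttt{+,-,*,/,**}; comparisons to \texttt{<,<=,==,!=,>=,>}; $\top,\bot,\neg,\wedge,\vee\mapsto$ \texttt{True}, \texttt{False}, \texttt{not}, \texttt{and}, \texttt{or}). Python states are stacks mapping variables to reals, identified with the states above; expressions evaluate by the corresponding real and Boolean operations. Small-step semantics of configurations $(s,\nu)$ ($\bot$ denotes the finished program): $(\texttt{x=}e,\nu)\rightarrow(\bot,\nu[x\mapsto u])$ if $e$ evaluates to $u$ in $\nu$; $(\texttt{if } e\texttt{: } s \texttt{ else: } s',\nu)\rightarrow(s,\nu)$ if $e$ evaluates to \texttt{True} and $\rightarrow(s',\nu)$ if to \texttt{False}; $(\texttt{while } e\texttt{: } s\texttt{ else pass},\nu)\rightarrow(s;\texttt{while } e\texttt{: } s\texttt{ else pass},\nu)$ if $e$ evaluates to \texttt{True} and $\rightarrow(\texttt{pass},\nu)$ if to \texttt{False}; $(\texttt{pass},\nu)\rightarrow(\bot,\nu)$; if $(s,\nu)\rightarrow(t,\mu)$ then $(s;s',\nu)\rightarrow(t;s',\mu)$; $(\bot;s',\nu)\rightarrow(s',\nu)$. $\rightarrow^*$ is the reflexive transitive closure. -}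

module Defs where

open import Data.Nat using (ℕ; _≟_)
open import Data.Bool using (Bool; true; false; not; _∧_; _∨_)
open import Data.Product using (Σ; _×_; _,_)
open import Data.Sum using (_⊎_)
open import Data.Unit using (⊤)
open import Data.Empty using (⊥)
open import Relation.Nullary using (¬_; Dec; yes; no)
open import Relation.Nullary.Decidable using (⌊_⌋)
open import Relation.Binary.PropositionalEquality using (_≡_)
open import Relation.Binary.Construct.Closure.ReflexiveTransitive using (Star)

-- The value domain ℝ (also the Python float type, identified with ℝ).
-- agda-stdlib has no real numbers, so the domain is an abstract carrier
-- with the operations the syntax mentions; the order/equality relations
-- come with decision procedures (classically true for ℝ), which Python
-- uses to compute Boolean values of comparisons.

record RealOps : Set₁ where
  field
    Carrier : Set
    _+_ _-_ _·_ _/_ _^_ : Carrier → Carrier → Carrier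
    -_  : Carrier → Carrier
    _<_ _≤_ : Carrier → Carrier → Set
    _<?_ : (a b : Carrier) → Dec (a < b)
    _≤?_ : (a b : Carrier) → Dec (a ≤ b)
    _≟ᵣ_ : (a b : Carrier) → Dec (a ≡ b)

Var : Set
Var = ℕ

module _ (R : RealOps) where
  open RealOps R

  State : Set
  State = Var → Carrier

  upd : State → Var → Carrier → State
  upd ν x u y with x ≟ y
  ... | yes _ = u
  ... | no  _ = ν y

  data Term : Set where
    lit  : Carrier → Term
    var  : Var → Term
    neg  : Term → Term
    _⊕_ _⊖_ _⊗_ _⊘_ _⊛_ : Term → Term → Term

  data Fml : Set where
    _≺_ _≼_ _≐_ _≠_ _≽_ _≻_ : Term → Term → Fml
    tt ff : Fml
    ¬F : Fml → Fml
    _∧F_ _∨F_ : Fml → Fml → Fml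

  data HP : Set where
    _≔_  : Var → Term → HP
    ¿_   : Fml → HP
    _⨾_  : HP → HP → HP
    _∪_  : HP → HP → HP
    _*   : HP → HP

  ⟦_⟧ₜ : Term → State → Carrier
  ⟦ lit c ⟧ₜ ν = c
  ⟦ var x ⟧ₜ ν = ν x
  ⟦ neg t ⟧ₜ ν = - ⟦ t ⟧ₜ ν
  ⟦ s ⊕ t ⟧ₜ ν = ⟦ s ⟧ₜ ν + ⟦ t ⟧ₜ ν
  ⟦ s ⊖ t ⟧ₜ ν = ⟦ s ⟧ₜ ν - ⟦ t ⟧ₜ ν
  ⟦ s ⊗ t ⟧ₜ ν = ⟦ s ⟧ₜ ν · ⟦ t ⟧ₜ ν
  ⟦ s ⊘ t ⟧ₜ ν = ⟦ s ⟧ₜ ν / ⟦ t ⟧ₜ ν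
  ⟦ s ⊛ t ⟧ₜ ν = ⟦ s ⟧ₜ ν ^ ⟦ t ⟧ₜ ν

  _⊨_ : State → Fml → Set
  ν ⊨ (s ≺ t) = ⟦ s ⟧ₜ ν < ⟦ t ⟧ₜ ν
  ν ⊨ (s ≼ t) = ⟦ s ⟧ₜ ν ≤ ⟦ t ⟧ₜ ν
  ν ⊨ (s ≐ t) = ⟦ s ⟧ₜ ν ≡ ⟦ t ⟧ₜ ν
  ν ⊨ (s ≠ t) = ¬ (⟦ s ⟧ₜ ν ≡ ⟦ t ⟧ₜ ν)
  ν ⊨ (s ≽ t) = ⟦ t ⟧ₜ ν ≤ ⟦ s ⟧ₜ ν
  ν ⊨ (s ≻ t) = ⟦ t ⟧ₜ ν < ⟦ s ⟧ₜ ν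
  ν ⊨ tt = ⊤
  ν ⊨ ff = ⊥
  ν ⊨ ¬F P = ¬ (ν ⊨ P)
  ν ⊨ (P ∧F Q) = (ν ⊨ P) × (ν ⊨ Q)
  ν ⊨ (P ∨F Q) = (ν ⊨ P) ⊎ (ν ⊨ Q)

  ⟦_⟧ : HP → State → State → Set
  ⟦ x ≔ θ ⟧ ν ω = ω ≡ upd ν x (⟦ θ ⟧ₜ ν)
  ⟦ ¿ P ⟧ ν ω = (ω ≡ ν) × (ν ⊨ P)
  ⟦ α ⨾ β ⟧ ν ω = Σ State λ μ → ⟦ α ⟧ ν μ × ⟦ β ⟧ μ ω
  ⟦ α ∪ β ⟧ ν ω = ⟦ α ⟧ ν ω ⊎ ⟦ β ⟧ ν ω
  ⟦ α * ⟧ ν ω = Star ⟦ α ⟧ ν ω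

  data DetHP : Set where
    asgn  : Var → Term → DetHP
    seq   : DetHP → DetHP → DetHP
    ite   : Fml → DetHP → DetHP → DetHP
    loop  : Fml → DetHP → DetHP

  toHP : DetHP → HP
  toHP (asgn x θ) = x ≔ θ
  toHP (seq α β) = toHP α ⨾ toHP β
  toHP (ite P α β) = ((¿ P) ⨾ toHP α) ∪ ((¿ ¬F P) ⨾ toHP β)
  toHP (loop P α) = (((¿ P) ⨾ toHP α) *) ⨾ (¿ ¬F P)

  data PyExp : Set where
    pLit : Carrier → PyExp
    pVar : Var → PyExp
    pNeg : PyExp → PyExp
    pAdd pSub pMul pDiv pPow : PyExp → PyExp → PyExp

  data PyBExp : Set where
    pLt pLe pEq pNe pGe pGt : PyExp → PyExp → PyBExp
    pTrue pFalse : PyBExp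
    pNot : PyBExp → PyBExp
    pAnd pOr : PyBExp → PyBExp → PyBExp

  data PyStmt : Set where
    pAsgn  : Var → PyExp → PyStmt
    pSeq   : PyStmt → PyStmt → PyStmt
    pIf    : PyBExp → PyStmt → PyStmt → PyStmt
    pWhile : PyBExp → PyStmt → PyStmt         -- while e: s else pass
    pPass  : PyStmt
    pDone  : PyStmt                           -- ⊥ (finished program)

  evalE : PyExp → State → Carrier
  evalE (pLit c) ν = c
  evalE (pVar x) ν = ν x
  evalE (pNeg e) ν = - evalE e ν
  evalE (pAdd e f) ν = evalE e ν + evalE f ν
  evalE (pSub e f) ν = evalE e ν - evalE f ν
  evalE (pMul e f) ν = evalE e ν · evalE f ν
  evalE (pDiv e f) ν = evalE e ν / evalE f ν
  evalE (pPow e f) ν = evalE e ν ^ evalE f ν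

  evalB : PyBExp → State → Bool
  evalB (pLt e f) ν = ⌊ evalE e ν <? evalE f ν ⌋
  evalB (pLe e f) ν = ⌊ evalE e ν ≤? evalE f ν ⌋
  evalB (pEq e f) ν = ⌊ evalE e ν ≟ᵣ evalE f ν ⌋
  evalB (pNe e f) ν = not ⌊ evalE e ν ≟ᵣ evalE f ν ⌋
  evalB (pGe e f) ν = ⌊ evalE f ν ≤? evalE e ν ⌋
  evalB (pGt e f) ν = ⌊ evalE f ν <? evalE e ν ⌋
  evalB pTrue ν = true
  evalB pFalse ν = false
  evalB (pNot b) ν = not (evalB b ν)
  evalB (pAnd b c) ν = evalB b ν ∧ evalB c ν
  evalB (pOr b c) ν = evalB b ν ∨ evalB c ν

  Config : Set
  Config = PyStmt × State

  data _⟶_ : Config → Config → Set where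
    s-asgn   : ∀ {x e ν} → (pAsgn x e , ν) ⟶ (pDone , upd ν x (evalE e ν))
    s-ifT    : ∀ {e s s' ν} → evalB e ν ≡ true → (pIf e s s' , ν) ⟶ (s , ν)
    s-ifF    : ∀ {e s s' ν} → evalB e ν ≡ false → (pIf e s s' , ν) ⟶ (s' , ν)
    s-whileT : ∀ {e s ν} → evalB e ν ≡ true →
               (pWhile e s , ν) ⟶ (pSeq s (pWhile e s) , ν)
    s-whileF : ∀ {e s ν} → evalB e ν ≡ false → (pWhile e s , ν) ⟶ (pPass , ν)
    s-pass   : ∀ {ν} → (pPass , ν) ⟶ (pDone , ν)
    s-seq    : ∀ {s t s' ν μ} → (s , ν) ⟶ (t , μ) → (pSeq s s' , ν) ⟶ (pSeq t s' , μ)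
    s-done   : ∀ {s' ν} → (pSeq pDone s' , ν) ⟶ (s' , ν)

  _⟶*_ : Config → Config → Set
  _⟶*_ = Star _⟶_

  pyT : Term → PyExp
  pyT (lit c) = pLit c
  pyT (var x) = pVar x
  pyT (neg t) = pNeg (pyT t)
  pyT (s ⊕ t) = pAdd (pyT s) (pyT t)
  pyT (s ⊖ t) = pSub (pyT s) (pyT t)
  pyT (s ⊗ t) = pMul (pyT s) (pyT t)
  pyT (s ⊘ t) = pDiv (pyT s) (pyT t)
  pyT (s ⊛ t) = pPow (pyT s) (pyT t)

  pyF : Fml → PyBExp
  pyF (s ≺ t) = pLt (pyT s) (pyT t)
  pyF (s ≼ t) = pLe (pyT s) (pyT t)
  pyF (s ≐ t) = pEq (pyT s) (pyT t)
  pyF (s ≠ t) = pNe (pyT s) (pyT t)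
  pyF (s ≽ t) = pGe (pyT s) (pyT t)
  pyF (s ≻ t) = pGt (pyT s) (pyT t)
  pyF tt = pTrue
  pyF ff = pFalse
  pyF (¬F P) = pNot (pyF P)
  pyF (P ∧F Q) = pAnd (pyF P) (pyF Q)
  pyF (P ∨F Q) = pOr (pyF P) (pyF Q)

  Py : DetHP → PyStmt
  Py (asgn x θ) = pAsgn x (pyT θ)
  Py (seq α β) = pSeq (Py α) (Py β)
  Py (ite P α β) = pIf (pyF P) (Py α) (Py β)
  Py (loop P α) = pWhile (pyF P) (Py α)

-- The small-step run is first turned into a big-step derivation, by
-- expanding backwards one step at a time.  On big-step derivations the
-- proof is by induction on α: a compiled guard evaluates to true exactly
-- when the source formula holds, and each executed iteration of a
-- while loop contributes one ?P;α step to the star, the final false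
-- test supplying ?¬P.
module Submission where

open import Defs
open import Data.Product using (_,_)
open import Data.Bool using (true; false)
open import Data.Sum using (inj₁; inj₂)
open import Relation.Nullary using (¬_; Dec)
open import Relation.Nullary.Decidable using (⌊_⌋; isYes≗does)
open import Relation.Nullary.Reflects
  using (Reflects; ofʸ; ofⁿ; invert; ¬-reflects; _×-reflects_; _⊎-reflects_)
open import Relation.Binary.PropositionalEquality using (_≡_; refl; cong; cong₂; sym; subst)
open import Relation.Binary.Construct.Closure.ReflexiveTransitive using (ε; _◅_)

module _ {a} {A : Set a} where

  isYes-reflects : (a? : Dec A) → Reflects A ⌊ a? ⌋
  isYes-reflects a? = subst (Reflects A) (sym (isYes≗does a?)) (Dec.proof a?)

  reflects-true : ∀ {b} → Reflects A b → b ≡ true → A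
  reflects-true r refl = invert r

  reflects-false : ∀ {b} → Reflects A b → b ≡ false → ¬ A
  reflects-false r refl = invert r

module _ (R : RealOps) where
  open RealOps R

  evalE-pyT : ∀ t ν → evalE R (pyT R t) ν ≡ ⟦_⟧ₜ R t ν
  evalE-pyT (lit c) ν = refl
  evalE-pyT (var x) ν = refl
  evalE-pyT (neg t) ν = cong -_ (evalE-pyT t ν)
  evalE-pyT (s ⊕ t) ν = cong₂ _+_ (evalE-pyT s ν) (evalE-pyT t ν)
  evalE-pyT (s ⊖ t) ν = cong₂ _-_ (evalE-pyT s ν) (evalE-pyT t ν)
  evalE-pyT (s ⊗ t) ν = cong₂ _·_ (evalE-pyT s ν) (evalE-pyT t ν)
  evalE-pyT (s ⊘ t) ν = cong₂ _/_ (evalE-pyT s ν) (evalE-pyT t ν)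
  evalE-pyT (s ⊛ t) ν = cong₂ _^_ (evalE-pyT s ν) (evalE-pyT t ν)

  evalB-pyF-reflects : ∀ P ν → Reflects (_⊨_ R ν P) (evalB R (pyF R P) ν)
  evalB-pyF-reflects (s ≺ t) ν rewrite evalE-pyT s ν | evalE-pyT t ν = isYes-reflects (_ <? _)
  evalB-pyF-reflects (s ≼ t) ν rewrite evalE-pyT s ν | evalE-pyT t ν = isYes-reflects (_ ≤? _)
  evalB-pyF-reflects (s ≐ t) ν rewrite evalE-pyT s ν | evalE-pyT t ν = isYes-reflects (_ ≟ᵣ _)
  evalB-pyF-reflects (s ≠ t) ν rewrite evalE-pyT s ν | evalE-pyT t ν =
    ¬-reflects (isYes-reflects (_ ≟ᵣ _))
  evalB-pyF-reflects (s ≽ t) ν rewrite evalE-pyT s ν | evalE-pyT t ν = isYes-reflects (_ ≤? _)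
  evalB-pyF-reflects (s ≻ t) ν rewrite evalE-pyT s ν | evalE-pyT t ν = isYes-reflects (_ <? _)
  evalB-pyF-reflects tt ν = ofʸ _
  evalB-pyF-reflects ff ν = ofⁿ λ ()
  evalB-pyF-reflects (¬F P) ν = ¬-reflects (evalB-pyF-reflects P ν)
  evalB-pyF-reflects (P ∧F Q) ν = evalB-pyF-reflects P ν ×-reflects evalB-pyF-reflects Q ν
  evalB-pyF-reflects (P ∨F Q) ν = evalB-pyF-reflects P ν ⊎-reflects evalB-pyF-reflects Q ν

  infix 4 _⇓_

  data _⇓_ : Config R → State R → Set where
    ⇓-done   : ∀ {ν} → (pDone , ν) ⇓ ν
    ⇓-pass   : ∀ {ν} → (pPass , ν) ⇓ ν
    ⇓-asgn   : ∀ {x e ν} → (pAsgn x e , ν) ⇓ upd R ν x (evalE R e ν)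
    ⇓-seq    : ∀ {s s' ν μ ω} → (s , ν) ⇓ μ → (s' , μ) ⇓ ω → (pSeq s s' , ν) ⇓ ω
    ⇓-ifT    : ∀ {e s s' ν ω} → evalB R e ν ≡ true → (s , ν) ⇓ ω → (pIf e s s' , ν) ⇓ ω
    ⇓-ifF    : ∀ {e s s' ν ω} → evalB R e ν ≡ false → (s' , ν) ⇓ ω → (pIf e s s' , ν) ⇓ ω
    ⇓-whileT : ∀ {e s ν μ ω} → evalB R e ν ≡ true → (s , ν) ⇓ μ →
               (pWhile e s , μ) ⇓ ω → (pWhile e s , ν) ⇓ ω
    ⇓-whileF : ∀ {e s ν} → evalB R e ν ≡ false → (pWhile e s , ν) ⇓ ν

  ⟶-expand-⇓ : ∀ {c c' ω} → _⟶_ R c c' → c' ⇓ ω → c ⇓ ω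
  ⟶-expand-⇓ s-asgn             ⇓-done         = ⇓-asgn
  ⟶-expand-⇓ (s-ifT e≡true)     c'⇓            = ⇓-ifT e≡true c'⇓
  ⟶-expand-⇓ (s-ifF e≡false)    c'⇓            = ⇓-ifF e≡false c'⇓
  ⟶-expand-⇓ (s-whileT e≡true)  (⇓-seq s⇓ w⇓)  = ⇓-whileT e≡true s⇓ w⇓
  ⟶-expand-⇓ (s-whileF e≡false) ⇓-pass         = ⇓-whileF e≡false
  ⟶-expand-⇓ s-pass             ⇓-done         = ⇓-pass
  ⟶-expand-⇓ (s-seq step)       (⇓-seq t⇓ s'⇓) = ⇓-seq (⟶-expand-⇓ step t⇓) s'⇓
  ⟶-expand-⇓ s-done             s'⇓            = ⇓-seq ⇓-done s'⇓

  ⟶*⇒⇓ : ∀ {c ω} → _⟶*_ R c (pDone , ω) → c ⇓ ω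
  ⟶*⇒⇓ ε            = ⇓-done
  ⟶*⇒⇓ (step ◅ run) = ⟶-expand-⇓ step (⟶*⇒⇓ run)

  Sound : DetHP R → Set
  Sound α = ∀ {ν ω} → (Py R α , ν) ⇓ ω → ⟦_⟧ R (toHP R α) ν ω

  loop-sound : ∀ P α → Sound α → Sound (loop P α)
  loop-sound P α α-sound (⇓-whileT {ν = ν} {μ = μ} P≡true α⇓ loop⇓)
    with loop-sound P α α-sound loop⇓
  ... | κ , iterations , exit = κ , (first ◅ iterations) , exit
    where
    first : ⟦_⟧ R ((¿ P) ⨾ toHP R α) ν μ
    first = ν , (refl , reflects-true (evalB-pyF-reflects P ν) P≡true) , α-sound α⇓
  loop-sound P α α-sound (⇓-whileF {ν = ν} P≡false) =
    ν , ε , (refl , reflects-false (evalB-pyF-reflects P ν) P≡false)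

  Py-sound : ∀ α → Sound α
  Py-sound (asgn x θ) {ν} ⇓-asgn = cong (upd R ν x) (evalE-pyT θ ν)
  Py-sound (seq α β) (⇓-seq α⇓ β⇓) = _ , Py-sound α α⇓ , Py-sound β β⇓
  Py-sound (ite P α β) (⇓-ifT {ν = ν} P≡true α⇓) =
    inj₁ (ν , (refl , reflects-true (evalB-pyF-reflects P ν) P≡true) , Py-sound α α⇓)
  Py-sound (ite P α β) (⇓-ifF {ν = ν} P≡false β⇓) =
    inj₂ (ν , (refl , reflects-false (evalB-pyF-reflects P ν) P≡false) , Py-sound β β⇓)
  Py-sound (loop P α) = loop-sound P α (Py-sound α)

theorem6 : (R : RealOps) (α : DetHP R) (ν ω : State R) →
           _⟶*_ R (Py R α , ν) (pDone , ω) →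
           ⟦_⟧ R (toHP R α) ν ω
theorem6 R α ν ω run = Py-sound R α (⟶*⇒⇓ R run)
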